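{- Let $G=\langle V,E,L\rangle$ and $G'=\langle V',E',L'\rangle$ be finite fuzzy graphs and run Algorithm B (described in the context) on them, with any choices of iteration orders and of the pairs extracted from $R$. Then each time the condition of the main while loop is tested, the following hold: (1) the largest directed simulation between $G$ and $G'$ is a subset of $Z$; (2) for all $r\in\Sigma_E$, $y\in V$, $x'\in V'$ and $x\in\mathrm{Prev}_r(y)$ with $(x,x')\in Z$, we have $E(x,r,y)\le\sup\{E'(x',r,z')\mid z'\in\mathrm{Next}'_r(x'),\ (y,z')\in Z\cup R\}$; (3) for all $r\in\Sigma_E$, $x\in V$, $y'\in V'$ and $x'\in\mathrm{Prev}'_r(y')$ with $(x,x')\in Z$, we have $E'(x',r,y')\le\sup\{E(x,r,y)\mid y\in\mathrm{Next}_r(x),\ (y,y')\in Z\cup R\}$.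
   Context: A fuzzy graph over finite sets $\Sigma_V,\Sigma_E$ is $G=\langle V,E,L\rangle$ with $E: V\times\Sigma_E\times V\to[0,1]$, $L: V\to(\Sigma_V\to[0,1])$; $f\le g$ for $f,g:\Sigma_V\to[0,1]$ means pointwise. $Z\subseteq V\times V'$ (possibly empty) is a directed simulation between $G$ and $G'=\langle V',E',L'\rangle$ if for all $x,y\in V$, $x',y'\in V'$, $r\in\Sigma_E$: $(x,x')\in Z$ implies $L(x)\le L'(x')$; $(x,x')\in Z$ and $E(x,r,y)>0$ imply there is $y'\in V'$ with $(y,y')\in Z$ and $E(x,r,y)\le E'(x',r,y')$; $(x,x')\in Z$ and $E'(x',r,y')>0$ imply there is $y\in V$ with $(y,y')\in Z$ and $E'(x',r,y')\le E(x,r,y)$. Notation: $\mathrm{Next}_r(x)=\{y\in V:E(x,r,y)>0\}$, $\mathrm{Prev}_r(y)=\{x\in V: E(x,r,y)>0\}$, $\mathrm{Next}'_r(x')=\{y'\in V':E'(x',r,y')>0\}$, $\mathrm{Prev}'_r(y')=\{x'\in V':E'(x',r,y')>0\}$; suprema in $[0,1]$, $\sup\emptyset=0$. Algorithm B maintains $Z,R\subseteq V\times V'$. ProcessPrev$(r,y,x')$: let $d=\sup\{E'(x',r,y')\mid y'\in\mathrm{Next}'_r(x'),(y,y')\in Z\cup R\}$; for each $x\in\mathrm{Prev}_r(y)$, if $E(x,r,y)>d$ and $(x,x')\in Z$, move $(x,x')$ from $Z$ to $R$. ProcessPrev$'(r,x,y')$: let $d=\sup\{E(x,r,y)\mid y\in\mathrm{Next}_r(x),(y,y')\in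 Z\cup R\}$; for each $x'\in\mathrm{Prev}'_r(y')$, if $E'(x',r,y')>d$ and $(x,x')\in Z$, move $(x,x')$ from $Z$ to $R$. Algorithm B: $Z:=\{(x,x')\mid L(x)\le L'(x')\}$, $R:=\emptyset$; for each $(r,y,x')\in\Sigma_E\times V\times V'$ call ProcessPrev$(r,y,x')$; for each $(r,x,y')\in\Sigma_E\times V\times V'$ call ProcessPrev$'(r,x,y')$; while $R\ne\emptyset$: remove some pair $(y,y')$ from $R$, for each $r\in\Sigma_E$ and $x'\in\mathrm{Prev}'_r(y')$ call ProcessPrev$(r,y,x')$, and for each $r\in\Sigma_E$ and $x\in\mathrm{Prev}_r(y)$ call ProcessPrev$'(r,x,y')$; return $Z$. -}

module Defs where

open import Level using (Level)
open import Data.Nat using (ℕ)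
open import Data.Fin using (Fin)
open import Data.Fin.Properties using () renaming (_≟_ to _≟F_)
open import Data.Bool using (Bool; true; false; _∧_; _∨_; not; if_then_else_)
open import Data.List using (List; []; _∷_; foldr; map; concatMap; allFin; filterᵇ)
open import Data.List.Relation.Binary.Permutation.Propositional using (_↭_)
open import Data.Product using (_×_; _,_; ∃)
open import Relation.Nullary using (¬_; does)
open import Relation.Binary.Bundles using (DecTotalOrder)
open import Relation.Binary.PropositionalEquality using (_≡_)

-- Fuzzy values live in an arbitrary decidable total order with a distinguished
-- value 𝟘 (playing the role of 0; the statement additionally assumes it is the
-- least element).  [0,1] with its usual order is the intended instance.
module FG {c ℓ₁ ℓ₂ : Level} (O : DecTotalOrder c ℓ₁ ℓ₂) (𝟘 : DecTotalOrder.Carrier O) where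
  open DecTotalOrder O renaming (Carrier to A)

  _>_ : A → A → Set ℓ₂
  a > b = ¬ (a ≤ b)

  _>ᵇ_ : A → A → Bool
  a >ᵇ b = not (does (a ≤? b))

  _⊔_ : A → A → A
  a ⊔ b = if does (a ≤? b) then b else a

  supOver : ∀ {k : ℕ} → (Fin k → Bool) → (Fin k → A) → A
  supOver {k} p f = foldr (λ i acc → if p i then f i ⊔ acc else acc) 𝟘 (allFin k)

  -- fuzzy graph over Σ_V = Fin nV, Σ_E = Fin nE, with vertex set Fin size
  record FuzzyGraph (nV nE : ℕ) : Set c where
    field
      size : ℕ
      E    : Fin size → Fin nE → Fin size → A
      L    : Fin size → Fin nV → A

  module Between {nV nE : ℕ} (G G' : FuzzyGraph nV nE) where
    open FuzzyGraph G
    open FuzzyGraph G' using () renaming (size to size'; E to E'; L to L')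

    V  = Fin size
    V' = Fin size'

    IsDirSim : (V → V' → Set) → Set ℓ₂
    IsDirSim S =
      (∀ x x' → S x x' → ∀ a → L x a ≤ L' x' a) ×
      (∀ x x' r y → S x x' → E x r y > 𝟘 →
         ∃ λ y' → S y y' × E x r y ≤ E' x' r y') ×
      (∀ x x' r y' → S x x' → E' x' r y' > 𝟘 →
         ∃ λ y → S y y' × E' x' r y' ≤ E x r y)

    IsLargestDirSim : (V → V' → Set) → Set (Level.suc Level.zero Level.⊔ ℓ₂)
    IsLargestDirSim S = IsDirSim S × (∀ S' → IsDirSim S' → ∀ x x' → S' x x' → S x x')

    record State : Set where
      constructor ⟨_,_⟩
      field
        Z : V → V' → Bool
        R : V → V' → Bool
    open State public

    eqᵇ : V' → V' → Bool
    eqᵇ a b = does (a ≟F b)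

    eqᵇ₀ : V → V → Bool
    eqᵇ₀ a b = does (a ≟F b)

    pos : A → Bool
    pos a = a >ᵇ 𝟘

    processPrev : Fin nE → V → V' → State → State
    processPrev r y x' ⟨ Z , R ⟩ = ⟨ Z₁ , R₁ ⟩
      where
        d : A
        d = supOver (λ y' → pos (E' x' r y') ∧ (Z y y' ∨ R y y')) (E' x' r)
        mv : V → V' → Bool
        mv x z' = pos (E x r y) ∧ (E x r y >ᵇ d) ∧ eqᵇ z' x' ∧ Z x z'
        Z₁ : V → V' → Bool
        Z₁ x z' = Z x z' ∧ not (mv x z')
        R₁ : V → V' → Bool
        R₁ x z' = R x z' ∨ mv x z'

    processPrev' : Fin nE → V → V' → State → State
    processPrev' r x y' ⟨ Z , R ⟩ = ⟨ Z₁ , R₁ ⟩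
      where
        d : A
        d = supOver (λ y → pos (E x r y) ∧ (Z y y' ∨ R y y')) (E x r)
        mv : V → V' → Bool
        mv z x' = pos (E' x' r y') ∧ (E' x' r y' >ᵇ d) ∧ eqᵇ₀ z x ∧ Z z x'
        Z₁ : V → V' → Bool
        Z₁ z x' = Z z x' ∧ not (mv z x')
        R₁ : V → V' → Bool
        R₁ z x' = R z x' ∨ mv z x'

    data Call : Set where
      pp  : Fin nE → V → V' → Call
      pp' : Fin nE → V → V' → Call

    exec : Call → State → State
    exec (pp r y x') = processPrev r y x'
    exec (pp' r x y') = processPrev' r x y'

    run : List Call → State → State
    run []       s = s
    run (c ∷ cs) s = run cs (exec c s)

    labelLeq : V → V' → Bool
    labelLeq x x' = foldr (λ a acc → does (L x a ≤? L' x' a) ∧ acc) true (allFin nV)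

    initState : State
    initState = ⟨ labelLeq , (λ _ _ → false) ⟩

    initCalls₁ : List Call
    initCalls₁ = concatMap (λ r → concatMap (λ y → map (pp r y) (allFin size')) (allFin size)) (allFin nE)

    initCalls₂ : List Call
    initCalls₂ = concatMap (λ r → concatMap (λ x → map (pp' r x) (allFin size')) (allFin size)) (allFin nE)

    bodyCalls₁ : V → V' → List Call
    bodyCalls₁ y y' = concatMap (λ r → map (pp r y) (filterᵇ (λ x' → pos (E' x' r y')) (allFin size'))) (allFin nE)

    bodyCalls₂ : V → V' → List Call
    bodyCalls₂ y y' = concatMap (λ r → map (λ x → pp' r x y') (filterᵇ (λ x → pos (E x r y)) (allFin size))) (allFin nE)

    removeR : V → V' → State → State
    removeR y y' ⟨ Z , R ⟩ = ⟨ Z , (λ x x' → R x x' ∧ not (eqᵇ₀ x y ∧ eqᵇ x' y')) ⟩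

    -- LoopTest s : s is a state in which the while-condition "R ≠ ∅" is tested,
    -- for some run of Algorithm B (any iteration orders, any extracted pairs).
    data LoopTest : State → Set where
      init : ∀ cs₁ cs₂ → cs₁ ↭ initCalls₁ → cs₂ ↭ initCalls₂ →
             LoopTest (run cs₂ (run cs₁ initState))
      iter : ∀ {s} y y' → LoopTest s → R s y y' ≡ true →
             ∀ cs₁ cs₂ → cs₁ ↭ bodyCalls₁ y y' → cs₂ ↭ bodyCalls₂ y y' →
             LoopTest (run cs₂ (run cs₁ (removeR y y' s)))

-- Invariant: every directed simulation lies in Z, and every pair (x, x') in Z is supported,
-- i.e. E(x,r,y) is at most the threshold d that ProcessPrev(r,y,x') would compute from the
-- current Z ∪ R (and dually for ProcessPrev'). A call only moves pairs from Z to R, so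
-- Z ∪ R, hence every threshold, is unchanged while Z shrinks: supports persist, and the call
-- makes its own triple supported. It never removes a pair of a simulation S ⊆ Z, since the
-- successor that S provides is counted in d. Deleting (y, y') from R can lower only the
-- thresholds of (r, y, x') with x' ∈ Prev'_r(y') and (r, x, y') with x ∈ Prev_r(y), and
-- those are exactly the calls made by the loop body.
module Submission where

open import Defs
open import Level using (Level; 0ℓ) renaming (suc to lsuc; _⊔_ to _⊔ℓ_)
open import Data.Nat using (ℕ)
open import Data.Bool using (Bool; true; false; _∧_; _∨_; not; if_then_else_)
open import Data.Bool.Properties using (∨-zeroʳ; ∨-identityʳ; ∧-identityʳ; T-≡)
open import Data.Fin using (Fin)
open import Data.Fin.Properties using () renaming (_≟_ to _≟F_)
open import Data.List using ([]; _∷_; foldr; allFin)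
open import Data.List.Properties using (foldr-cong)
open import Data.List.Relation.Unary.Any using (here; there)
open import Data.List.Membership.Propositional using (_∈_; lose)
open import Data.List.Membership.Propositional.Properties using (∈-allFin; ∈-map⁺; ∈-concatMap⁺; ∈-filter⁺)
open import Data.List.Relation.Binary.Permutation.Propositional using (_↭_; ↭-sym)
open import Data.List.Relation.Binary.Permutation.Propositional.Properties using (∈-resp-↭)
open import Data.Product using (_×_; _,_; proj₁; proj₂; ∃)
open import Data.Sum using (_⊎_; inj₁; inj₂)
open import Data.Empty using (⊥-elim)
open import Function using (_∘_; id; case_of_)
open import Function.Bundles using (Equivalence)
open import Relation.Nullary using (¬_; yes; no; does)
open import Relation.Nullary.Decidable using (dec-true; dec-false; T?)
open import Relation.Binary.Bundles using (DecTotalOrder)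
import Relation.Binary.Properties.DecTotalOrder as DecTotalOrderProperties
open import Relation.Binary.PropositionalEquality using (_≡_; refl; sym; trans; cong; subst)

move-preserves-∨ : ∀ z r m → (m ≡ true → z ≡ true) → (z ∧ not m) ∨ (r ∨ m) ≡ z ∨ r
move-preserves-∨ true  r false _   = refl
move-preserves-∨ true  r true  _   = ∨-zeroʳ r
move-preserves-∨ false r false _   = ∨-identityʳ r
move-preserves-∨ false r true  m⇒z with () ← m⇒z refl

∧-≡trueʳ : ∀ a {b} → a ∧ b ≡ true → b ≡ true
∧-≡trueʳ true b≡true = b≡true

module Suprema {c ℓ₁ ℓ₂ : Level} (O : DecTotalOrder c ℓ₁ ℓ₂) (𝟘 : DecTotalOrder.Carrier O) where
  open DecTotalOrder O using (_≤_; _≤?_) renaming (Carrier to A; refl to ≤-refl; trans to ≤-trans)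
  open DecTotalOrderProperties O using (≰⇒≥)
  open FG O 𝟘

  x≤x⊔y : ∀ x y → x ≤ x ⊔ y
  x≤x⊔y x y with x ≤? y
  ... | yes x≤y = x≤y
  ... | no  _   = ≤-refl

  y≤x⊔y : ∀ x y → y ≤ x ⊔ y
  y≤x⊔y x y with x ≤? y
  ... | yes _   = ≤-refl
  ... | no  x≰y = ≰⇒≥ x≰y

  supOver-upperBound : ∀ {k} (p : Fin k → Bool) (f : Fin k → A) {i} → p i ≡ true → f i ≤ supOver p f
  supOver-upperBound {k} p f {i} pi≡true = go (allFin k) (∈-allFin i)
    where
    go : ∀ is → i ∈ is → f i ≤ foldr (λ j acc → if p j then f j ⊔ acc else acc) 𝟘 is
    go (_ ∷ is) (here refl) rewrite pi≡true = x≤x⊔y (f i) _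
    go (j ∷ is) (there i∈is) with p j
    ... | true  = ≤-trans (go is i∈is) (y≤x⊔y (f j) _)
    ... | false = go is i∈is

  supOver-cong : ∀ {k} {p q : Fin k → Bool} (f : Fin k → A) → (∀ i → p i ≡ q i) →
                 supOver p f ≡ supOver q f
  supOver-cong {k} f p≗q =
    foldr-cong (λ i acc → cong (λ b → if b then f i ⊔ acc else acc) (p≗q i)) refl (allFin k)

  >𝟘-≤-trans : ∀ {a b} → a > 𝟘 → a ≤ b → b > 𝟘
  >𝟘-≤-trans a>𝟘 a≤b b≤𝟘 = a>𝟘 (≤-trans a≤b b≤𝟘)

module ProcessPrev {c ℓ₁ ℓ₂ : Level} (O : DecTotalOrder c ℓ₁ ℓ₂) (𝟘 : DecTotalOrder.Carrier O)
                   {nV nE : ℕ} (G G' : FG.FuzzyGraph O 𝟘 nV nE) where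
  open DecTotalOrder O using (_≤_; _≤?_) renaming (Carrier to A; trans to ≤-trans)
  open FG O 𝟘
  open Suprema O 𝟘
  open FuzzyGraph G
  open FuzzyGraph G' using () renaming (E to E')
  open Between G G'

  >𝟘⇒pos : ∀ {a} → a > 𝟘 → pos a ≡ true
  >𝟘⇒pos {a} a>𝟘 = cong not (dec-false (a ≤? 𝟘) a>𝟘)

  d : State → Fin nE → V → V' → A
  d s r y x' = supOver (λ y' → pos (E' x' r y') ∧ (Z s y y' ∨ R s y y')) (E' x' r)

  d-upperBound : ∀ s r y x' {y'} → E' x' r y' > 𝟘 → Z s y y' ∨ R s y y' ≡ true → E' x' r y' ≤ d s r y x'
  d-upperBound s r y x' {y'} e'>𝟘 inZ∪R =
    supOver-upperBound (λ y' → pos (E' x' r y') ∧ (Z s y y' ∨ R s y y')) (E' x' r) counted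
    where
    counted : pos (E' x' r y') ∧ (Z s y y' ∨ R s y y') ≡ true
    counted rewrite >𝟘⇒pos e'>𝟘 = inZ∪R

  Supported : State → Fin nE → V → V' → Set ℓ₂
  Supported s r y x' = ∀ x → E x r y > 𝟘 → Z s x x' ≡ true → E x r y ≤ d s r y x'

  Forth : (V → V' → Set) → Set ℓ₂
  Forth S = ∀ x x' r y → S x x' → E x r y > 𝟘 → ∃ λ y' → S y y' × E x r y ≤ E' x' r y'

  _⊆Z_ : (V → V' → Set) → State → Set
  S ⊆Z s = ∀ x x' → S x x' → Z s x x' ≡ true

  d-cong : ∀ {s t r y x'} →
           (∀ y' → pos (E' x' r y') ≡ true → Z s y y' ∨ R s y y' ≡ Z t y y' ∨ R t y y') →
           d s r y x' ≡ d t r y x'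
  d-cong {s} {t} {r} {y} {x'} Z∪R≡ = supOver-cong (E' x' r) pointwise
    where
    pointwise : ∀ y' → pos (E' x' r y') ∧ (Z s y y' ∨ R s y y')
                     ≡ pos (E' x' r y') ∧ (Z t y y' ∨ R t y y')
    pointwise y' with pos (E' x' r y') in pos≡true
    ... | true  = Z∪R≡ y' pos≡true
    ... | false = refl

  Supported-resp : ∀ {s t r y x'} → (∀ x → Z t x x' ≡ true → Z s x x' ≡ true) →
                   (∀ y' → pos (E' x' r y') ≡ true → Z s y y' ∨ R s y y' ≡ Z t y y' ∨ R t y y') →
                   Supported s r y x' → Supported t r y x'
  Supported-resp {s} {t} {r} {y} Z⊆ Z∪R≡ supported x e>𝟘 Zxx' =
    subst (E x r y ≤_) (d-cong {s} {t} Z∪R≡) (supported x e>𝟘 (Z⊆ x Zxx'))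

  Z-processPrev⁻ : ∀ r y x' s x z' → Z (processPrev r y x' s) x z' ≡ true →
                   Z s x z' ≡ true × (z' ≡ x' → E x r y > 𝟘 → E x r y ≤ d s r y x')
  Z-processPrev⁻ r y x' s x z' Z₁≡true with E x r y ≤? 𝟘 | E x r y ≤? d s r y x' | z' ≟F x' | Z s x z'
  ... | yes e≤𝟘 | _       | _       | true = refl , λ _ e>𝟘 → ⊥-elim (e>𝟘 e≤𝟘)
  ... | no  _   | yes e≤d | _       | true = refl , λ _ _ → e≤d
  ... | no  _   | no  _   | no z'≢x' | true = refl , λ z'≡x' → ⊥-elim (z'≢x' z'≡x')
  ... | no  _   | no  _   | yes refl | true with () ← Z₁≡true
  ... | _       | _       | _        | false with () ← Z₁≡true

  Z-processPrev⁺ : ∀ r y x' s x z' → Z s x z' ≡ true →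
                   (z' ≡ x' → E x r y > 𝟘 → E x r y ≤ d s r y x') → Z (processPrev r y x' s) x z' ≡ true
  Z-processPrev⁺ r y x' s x z' Zxz' justified
    with E x r y ≤? 𝟘 | E x r y ≤? d s r y x' | z' ≟F x' | Z s x z'
  ... | yes _   | _       | _        | true = refl
  ... | no  _   | yes _   | _        | true = refl
  ... | no  _   | no  _   | no  _    | true = refl
  ... | no  e>𝟘 | no  e≰d | yes refl | true = ⊥-elim (e≰d (justified refl e>𝟘))
  ... | _       | _       | _        | false with () ← Zxz'

  Z∪R-processPrev : ∀ r y x' s x z' →
                    Z (processPrev r y x' s) x z' ∨ R (processPrev r y x' s) x z' ≡ Z s x z' ∨ R s x z'
  Z∪R-processPrev r y x' s x z' = move-preserves-∨ (Z s x z') (R s x z') _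
    (∧-≡trueʳ (eqᵇ z' x') ∘ ∧-≡trueʳ (E x r y >ᵇ d s r y x') ∘ ∧-≡trueʳ (pos (E x r y)))

  processPrev-establishes : ∀ r y x' s → Supported (processPrev r y x' s) r y x'
  processPrev-establishes r y x' s x e>𝟘 Z₁xx' =
    subst (E x r y ≤_) (d-cong {s} {processPrev r y x' s} λ y' _ → sym (Z∪R-processPrev r y x' s y y'))
          (proj₂ (Z-processPrev⁻ r y x' s x x' Z₁xx') refl e>𝟘)

  processPrev-preserves-⊆Z : ∀ {S} r y x' s → Forth S → S ⊆Z s → S ⊆Z processPrev r y x' s
  processPrev-preserves-⊆Z {S} r y x' s forth S⊆Z x z' Sxz' =
    Z-processPrev⁺ r y x' s x z' (S⊆Z x z' Sxz') justified
    where
    justified : z' ≡ x' → E x r y > 𝟘 → E x r y ≤ d s r y x'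
    justified refl e>𝟘 with forth x x' r y Sxz' e>𝟘
    ... | y' , Syy' , e≤e' =
      ≤-trans e≤e' (d-upperBound s r y x' (>𝟘-≤-trans e>𝟘 e≤e') (cong (_∨ R s y y') (S⊆Z y y' Syy')))

module AlgorithmB {c ℓ₁ ℓ₂ : Level} (O : DecTotalOrder c ℓ₁ ℓ₂) (𝟘 : DecTotalOrder.Carrier O)
                  {nV nE : ℕ} (G G' : FG.FuzzyGraph O 𝟘 nV nE) where
  open DecTotalOrder O using (_≤_; _≤?_)
  open FG O 𝟘
  open FuzzyGraph G
  open FuzzyGraph G' using () renaming (E to E'; L to L')
  open Between G G'
  open ProcessPrev O 𝟘 G G'
  module Dual = ProcessPrev O 𝟘 G' G

  -- ProcessPrev'(r, x, y') on (G, G') is, definitionally, ProcessPrev(r, y', x) on (G', G)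
  -- acting on the transposed state, so each backward fact is a forward fact of Dual.
  transpose : State → Between.State G' G
  transpose s = record { Z = λ x' x → Z s x x' ; R = λ x' x → R s x x' }

  SupportedBack : State → Fin nE → V → V' → Set ℓ₂
  SupportedBack s r x y' = Dual.Supported (transpose s) r y' x

  exec-Z⊆ : ∀ c s x x' → Z (exec c s) x x' ≡ true → Z s x x' ≡ true
  exec-Z⊆ (pp  r y x') s x z' = proj₁ ∘ Z-processPrev⁻ r y x' s x z'
  exec-Z⊆ (pp' r x y') s z x' = proj₁ ∘ Dual.Z-processPrev⁻ r y' x (transpose s) x' z

  exec-Z∪R : ∀ c s x x' → Z (exec c s) x x' ∨ R (exec c s) x x' ≡ Z s x x' ∨ R s x x'
  exec-Z∪R (pp  r y x') s x z' = Z∪R-processPrev r y x' s x z'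
  exec-Z∪R (pp' r x y') s z x' = Dual.Z∪R-processPrev r y' x (transpose s) x' z

  Stable : ∀ {ℓ} → (State → Set ℓ) → Set ℓ
  Stable P = ∀ c s → P s → P (exec c s)

  Supported-stable : ∀ r y x' → Stable (λ s → Supported s r y x')
  Supported-stable r y x' c s =
    Supported-resp {s} {exec c s} (λ x → exec-Z⊆ c s x x') (λ y' _ → sym (exec-Z∪R c s y y'))

  SupportedBack-stable : ∀ r x y' → Stable (λ s → SupportedBack s r x y')
  SupportedBack-stable r x y' c s =
    Dual.Supported-resp {transpose s} {transpose (exec c s)}
      (λ x' → exec-Z⊆ c s x x') (λ y _ → sym (exec-Z∪R c s y y'))

  ⊆Z-stable : ∀ S → IsDirSim S → Stable (S ⊆Z_)
  ⊆Z-stable S (_ , forth , _) (pp r y x') s = processPrev-preserves-⊆Z r y x' s forth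
  ⊆Z-stable S (_ , _ , back) (pp' r x y') s S⊆Z z x' =
    Dual.processPrev-preserves-⊆Z r y' x (transpose s)
      (λ x' x r y' → back x x' r y') (λ x' x → S⊆Z x x') x' z

  run-stable : ∀ {ℓ} {P : State → Set ℓ} → Stable P → ∀ cs s → P s → P (run cs s)
  run-stable stable []       s Ps = Ps
  run-stable stable (c ∷ cs) s Ps = run-stable stable cs (exec c s) (stable c s Ps)

  run₂-stable : ∀ {ℓ} {P : State → Set ℓ} → Stable P → ∀ cs₁ cs₂ s → P s → P (run cs₂ (run cs₁ s))
  run₂-stable stable cs₁ cs₂ s = run-stable stable cs₂ _ ∘ run-stable stable cs₁ s

  run-establishes : ∀ {ℓ} {P : State → Set ℓ} → Stable P → ∀ {c cs} → c ∈ cs →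
                    (∀ s → P (exec c s)) → ∀ s → P (run cs s)
  run-establishes stable {cs = _ ∷ cs} (here refl) establishes s = run-stable stable cs _ (establishes s)
  run-establishes stable (there c∈cs) establishes s = run-establishes stable c∈cs establishes _

  pp-∈-initCalls₁ : ∀ r y x' → pp r y x' ∈ initCalls₁
  pp-∈-initCalls₁ r y x' =
    ∈-concatMap⁺ _ (lose (∈-allFin r)
      (∈-concatMap⁺ _ (lose (∈-allFin y) (∈-map⁺ (pp r y) (∈-allFin x')))))

  pp'-∈-initCalls₂ : ∀ r x y' → pp' r x y' ∈ initCalls₂
  pp'-∈-initCalls₂ r x y' =
    ∈-concatMap⁺ _ (lose (∈-allFin r)
      (∈-concatMap⁺ _ (lose (∈-allFin x) (∈-map⁺ (pp' r x) (∈-allFin y')))))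

  pp-∈-bodyCalls₁ : ∀ {y y' r x'} → pos (E' x' r y') ≡ true → pp r y x' ∈ bodyCalls₁ y y'
  pp-∈-bodyCalls₁ {y} {y'} {r} {x'} pos≡true =
    ∈-concatMap⁺ _ (lose (∈-allFin r) (∈-map⁺ (pp r y)
      (∈-filter⁺ (T? ∘ λ z' → pos (E' z' r y')) (∈-allFin x') (Equivalence.from T-≡ pos≡true))))

  pp'-∈-bodyCalls₂ : ∀ {y y' r x} → pos (E x r y) ≡ true → pp' r x y' ∈ bodyCalls₂ y y'
  pp'-∈-bodyCalls₂ {y} {y'} {r} {x} pos≡true =
    ∈-concatMap⁺ _ (lose (∈-allFin r) (∈-map⁺ (λ z → pp' r z y')
      (∈-filter⁺ (T? ∘ λ z → pos (E z r y)) (∈-allFin x) (Equivalence.from T-≡ pos≡true))))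

  R-removeR : ∀ y y' s x x' → ¬ (x ≡ y × x' ≡ y') → R (removeR y y' s) x x' ≡ R s x x'
  R-removeR y y' s x x' ≢yy' with x ≟F y | x' ≟F y'
  ... | yes x≡y | yes x'≡y' = ⊥-elim (≢yy' (x≡y , x'≡y'))
  ... | yes _   | no  _     = ∧-identityʳ (R s x x')
  ... | no  _   | _         = ∧-identityʳ (R s x x')

  removeR-preserves-Supported : ∀ y y' s {r y₀ x'} → (y₀ ≡ y → pos (E' x' r y') ≡ false) →
                                Supported s r y₀ x' → Supported (removeR y y' s) r y₀ x'
  removeR-preserves-Supported y y' s {r} {y₀} {x'} untouched =
    Supported-resp {s} {removeR y y' s} (λ _ → id) λ z' pos≡true →
      cong (Z s y₀ z' ∨_) (sym (R-removeR y y' s y₀ z' λ where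
        (refl , refl) → case trans (sym pos≡true) (untouched refl) of λ ()))

  removeR-preserves-SupportedBack : ∀ y y' s {r x y₀'} → (y₀' ≡ y' → pos (E x r y) ≡ false) →
                                    SupportedBack s r x y₀' → SupportedBack (removeR y y' s) r x y₀'
  removeR-preserves-SupportedBack y y' s {r} {x} {y₀'} untouched =
    Dual.Supported-resp {transpose s} {transpose (removeR y y' s)} (λ _ → id) λ z pos≡true →
      cong (Z s z y₀' ∨_) (sym (R-removeR y y' s z y₀' λ where
        (refl , refl) → case trans (sym pos≡true) (untouched refl) of λ ()))

  body₁-recomputes : ∀ y y' r y₀ x' → pp r y₀ x' ∈ bodyCalls₁ y y' ⊎ (y₀ ≡ y → pos (E' x' r y') ≡ false)
  body₁-recomputes y y' r y₀ x' with y₀ ≟F y | pos (E' x' r y') in pos≡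
  ... | yes refl | true  = inj₁ (pp-∈-bodyCalls₁ pos≡)
  ... | yes refl | false = inj₂ λ _ → refl
  ... | no  y₀≢y | _     = inj₂ (⊥-elim ∘ y₀≢y)

  body₂-recomputes : ∀ y y' r x y₀' → pp' r x y₀' ∈ bodyCalls₂ y y' ⊎ (y₀' ≡ y' → pos (E x r y) ≡ false)
  body₂-recomputes y y' r x y₀' with y₀' ≟F y' | pos (E x r y) in pos≡
  ... | yes refl | true  = inj₁ (pp'-∈-bodyCalls₂ pos≡)
  ... | yes refl | false = inj₂ λ _ → refl
  ... | no  y₀'≢y' | _   = inj₂ (⊥-elim ∘ y₀'≢y')

  labelLeq-complete : ∀ x x' → (∀ a → L x a ≤ L' x' a) → labelLeq x x' ≡ true
  labelLeq-complete x x' L≤L' = go (allFin nV)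
    where
    go : ∀ as → foldr (λ a acc → does (L x a ≤? L' x' a) ∧ acc) true as ≡ true
    go []       = refl
    go (a ∷ as) rewrite dec-true (L x a ≤? L' x' a) (L≤L' a) = go as

  Invariant : State → Set (lsuc 0ℓ ⊔ℓ ℓ₂)
  Invariant s = (∀ S → IsDirSim S → S ⊆Z s)
              × (∀ r y x' → Supported s r y x')
              × (∀ r x y' → SupportedBack s r x y')

  initial-invariant : ∀ cs₁ cs₂ → cs₁ ↭ initCalls₁ → cs₂ ↭ initCalls₂ →
                      Invariant (run cs₂ (run cs₁ initState))
  initial-invariant cs₁ cs₂ cs₁↭ cs₂↭ = simulations , forward , backward
    where
    simulations : ∀ S → IsDirSim S → S ⊆Z run cs₂ (run cs₁ initState)
    simulations S sim = run₂-stable (⊆Z-stable S sim) cs₁ cs₂ initState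
      λ x x' Sxx' → labelLeq-complete x x' (proj₁ sim x x' Sxx')

    forward : ∀ r y x' → Supported (run cs₂ (run cs₁ initState)) r y x'
    forward r y x' = run-stable (Supported-stable r y x') cs₂ _
      (run-establishes (Supported-stable r y x') (∈-resp-↭ (↭-sym cs₁↭) (pp-∈-initCalls₁ r y x'))
                       (processPrev-establishes r y x') initState)

    backward : ∀ r x y' → SupportedBack (run cs₂ (run cs₁ initState)) r x y'
    backward r x y' =
      run-establishes (SupportedBack-stable r x y') (∈-resp-↭ (↭-sym cs₂↭) (pp'-∈-initCalls₂ r x y'))
                      (λ t → Dual.processPrev-establishes r y' x (transpose t)) _

  iteration-preserves-invariant : ∀ s y y' cs₁ cs₂ → cs₁ ↭ bodyCalls₁ y y' → cs₂ ↭ bodyCalls₂ y y' →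
                                  Invariant s → Invariant (run cs₂ (run cs₁ (removeR y y' s)))
  iteration-preserves-invariant s y y' cs₁ cs₂ cs₁↭ cs₂↭ (simulations , forward , backward) =
    simulations′ , forward′ , backward′
    where
    s₀ : State
    s₀ = removeR y y' s

    simulations′ : ∀ S → IsDirSim S → S ⊆Z run cs₂ (run cs₁ s₀)
    simulations′ S sim = run₂-stable (⊆Z-stable S sim) cs₁ cs₂ s₀ (simulations S sim)

    forward′ : ∀ r y₀ x' → Supported (run cs₂ (run cs₁ s₀)) r y₀ x'
    forward′ r y₀ x' =
      run-stable (Supported-stable r y₀ x') cs₂ _ (afterCs₁ (body₁-recomputes y y' r y₀ x'))
      where
      afterCs₁ : pp r y₀ x' ∈ bodyCalls₁ y y' ⊎ (y₀ ≡ y → pos (E' x' r y') ≡ false) →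
                 Supported (run cs₁ s₀) r y₀ x'
      afterCs₁ (inj₁ called) = run-establishes (Supported-stable r y₀ x') (∈-resp-↭ (↭-sym cs₁↭) called)
                                               (processPrev-establishes r y₀ x') s₀
      afterCs₁ (inj₂ untouched) =
        run-stable (Supported-stable r y₀ x') cs₁ s₀
                   (removeR-preserves-Supported y y' s untouched (forward r y₀ x'))

    backward′ : ∀ r x y₀' → SupportedBack (run cs₂ (run cs₁ s₀)) r x y₀'
    backward′ r x y₀' with body₂-recomputes y y' r x y₀'
    ... | inj₁ called = run-establishes (SupportedBack-stable r x y₀') (∈-resp-↭ (↭-sym cs₂↭) called)
                                        (λ t → Dual.processPrev-establishes r y₀' x (transpose t)) _
    ... | inj₂ untouched =
      run₂-stable (SupportedBack-stable r x y₀') cs₁ cs₂ s₀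
                  (removeR-preserves-SupportedBack y y' s untouched (backward r x y₀'))

  loopTest⇒invariant : ∀ s → LoopTest s → Invariant s
  loopTest⇒invariant _ (init cs₁ cs₂ cs₁↭ cs₂↭) = initial-invariant cs₁ cs₂ cs₁↭ cs₂↭
  loopTest⇒invariant _ (iter y y' test _ cs₁ cs₂ cs₁↭ cs₂↭) =
    iteration-preserves-invariant _ y y' cs₁ cs₂ cs₁↭ cs₂↭ (loopTest⇒invariant _ test)

lemma3 : ∀ {c ℓ₁ ℓ₂ : Level} (O : DecTotalOrder c ℓ₁ ℓ₂) (𝟘 : DecTotalOrder.Carrier O) →
    (∀ a → DecTotalOrder._≤_ O 𝟘 a) →
    ∀ {nV nE : ℕ} (G G' : FG.FuzzyGraph O 𝟘 nV nE) →
    let open DecTotalOrder O using (_≤_)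
        open FG O 𝟘
        open FuzzyGraph G
        open FuzzyGraph G' using () renaming (E to E')
        open Between G G'
    in ∀ (s : State) → LoopTest s →
       (∀ (S : V → V' → _) → IsLargestDirSim S → ∀ x x' → S x x' → Z s x x' ≡ true)
       × (∀ r y x' x → E x r y > 𝟘 → Z s x x' ≡ true →
            E x r y ≤ supOver (λ z' → pos (E' x' r z') ∧ (Z s y z' ∨ R s y z')) (E' x' r))
       × (∀ r x y' x' → E' x' r y' > 𝟘 → Z s x x' ≡ true →
            E' x' r y' ≤ supOver (λ y → pos (E x r y) ∧ (Z s y y' ∨ R s y y')) (E x r))
lemma3 O 𝟘 _ G G' s test =
  let simulations , forward , backward = AlgorithmB.loopTest⇒invariant O 𝟘 G G' s test
  in (λ S largest → simulations S (proj₁ largest)) , forward , backward
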